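{- Let $\pi$ be a permutation with exactly two left to right maxima that does not end with its largest element. Suppose that a sequence $\sigma$ of distinct numbers contains a subsequence order isomorphic to a permutation in $R(\pi)$. Then $B(\sigma)$ contains a subsequence order isomorphic to $\pi$.
   Context: A left to right maximum of a sequence is a term larger than every term preceding it. For any finite sequence of distinct numbers, the operator $B$ is defined recursively by $B(\epsilon)=\epsilon$ and, writing a non-empty sequence as $\sigma=\sigma_1 m\sigma_2$ with $m$ its largest term, $B(\sigma)=B(\sigma_1)\sigma_2 m$. Subsequences need not be consecutive. For a permutation $\pi$ with exactly two left to right maxima that does not end with its largest term, write $\pi=a\alpha n\beta$ where $a$ is the first term, every term of $\alpha$ is less than $a$, $n$ is the largest term, and $\beta$ is non-empty. Then $R(\pi)$ is the set of permutations order isomorphic to some sequence of distinct numbers of the form $a\,x\,\lambda_1\,y\,\lambda_2\,z\,\mu$ or $x\,a\,\lambda_1\,y\,\lambda_2\,z\,\mu$ such that: the subsequence $a\lambda_1\lambda_2 z\mu$ is order isomorphic to $\pi$ (with $a\mapsto a$, $\lambda_1\lambda_2\mapsto\alpha$, $z\mapsto n$, $\mu\mapsto\beta$); $x>a$; $y$ and $z$ are the two largest terms of the sequence (in either order); and $x$ and $y$ may be the same term (in which case $\lambda_1$ is empty), and moreover if $a$ precedes $x$ and $\lambda_1$ is empty then $x$ and $y$ are the same term. -}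

module Defs where

open import Data.Nat using (ℕ; zero; suc; _<_; _<ᵇ_)
open import Data.Bool using (if_then_else_)
open import Data.List using (List; []; _∷_; _++_; [_]; length; map; upTo)
open import Data.List.Relation.Unary.All using (All)
open import Data.List.Relation.Unary.Unique.Propositional using (Unique)
open import Data.List.Relation.Binary.Pointwise using (Pointwise)
open import Data.List.Relation.Binary.Sublist.Propositional using (_⊆_)
open import Data.List.Relation.Binary.Permutation.Propositional using (_↭_)
open import Data.Maybe using (Maybe; just; nothing)
open import Data.Product using (Σ; ∃; _×_; _,_)
open import Function.Bundles using (_⇔_)
open import Relation.Binary.PropositionalEquality using (_≡_; _≢_)
open import Relation.Nullary using (¬_)

IsPerm : List ℕ → Set
IsPerm π = π ↭ map suc (upTo (length π))

-- Order isomorphism of finite sequences: same length, and for every pair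
-- of positions i < j the relative order of the entries agrees.
data _≅_ : List ℕ → List ℕ → Set where
  []  : [] ≅ []
  _∷_ : ∀ {x y xs ys} →
        Pointwise (λ x′ y′ → ((x < x′) ⇔ (y < y′)) × ((x′ < x) ⇔ (y′ < y))) xs ys →
        xs ≅ ys → (x ∷ xs) ≅ (y ∷ ys)

infix 4 _≅_

Contains : List ℕ → List ℕ → Set
Contains σ τ = ∃ λ s → s ⊆ σ × s ≅ τ

ltrMaxGo : Maybe ℕ → List ℕ → List ℕ
ltrMaxGo _ [] = []
ltrMaxGo nothing (x ∷ xs) = x ∷ ltrMaxGo (just x) xs
ltrMaxGo (just m) (x ∷ xs) =
  if m <ᵇ x then x ∷ ltrMaxGo (just x) xs else ltrMaxGo (just m) xs

ltrMaxima : List ℕ → List ℕ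
ltrMaxima = ltrMaxGo nothing

EndsWithMax : List ℕ → Set
EndsWithMax π = ∃ λ l → ∃ λ m → π ≡ l ++ [ m ] × All (_< m) l

record Split : Set where
  constructor split
  field
    left  : List ℕ
    mx    : ℕ
    right : List ℕ

splitMax : List ℕ → Maybe Split
splitMax [] = nothing
splitMax (x ∷ []) = just (split [] x [])
splitMax (x ∷ xs@(_ ∷ _)) with splitMax xs
... | nothing = just (split [] x xs)
... | just (split l m r) =
  if m <ᵇ x then just (split [] x xs) else just (split (x ∷ l) m r)

-- B(ε) = ε,  B(σ₁ m σ₂) = B(σ₁) σ₂ m ; fuel-based recursion (fuel = length suffices).
Bfuel : ℕ → List ℕ → List ℕ
Bfuel zero _ = []
Bfuel (suc k) σ with splitMax σ
... | nothing = []
... | just (split l m r) = Bfuel k l ++ r ++ [ m ]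

B : List ℕ → List ℕ
B σ = Bfuel (length σ) σ

-- Every term of ws is less than both y and z (so y, z are the two largest
-- terms of a sequence whose other terms are ws).
BelowBoth : ℕ → ℕ → List ℕ → Set
BelowBoth y z ws = All (λ w → w < y × w < z) ws

-- The subsequence a λ z μ (λ = λ₁λ₂) is order isomorphic to π = a α n β,
-- with a ↦ a, λ ↦ α, z ↦ n, μ ↦ β.
MatchesPi : List ℕ → ℕ → List ℕ → ℕ → List ℕ → Set
MatchesPi π a lam z μ =
  Σ ℕ λ a′ → Σ (List ℕ) λ α → Σ ℕ λ n → Σ (List ℕ) λ β →
    π ≡ a′ ∷ α ++ n ∷ β × length lam ≡ length α × length μ ≡ length β ×
    (a ∷ lam ++ z ∷ μ) ≅ π

data RForm (π : List ℕ) : List ℕ → Set where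
  -- a x λ₁ y λ₂ z μ with x ≠ y (then λ₁ must be non-empty)
  a-x-y : ∀ {a x y z λ₁ λ₂ μ} → λ₁ ≢ [] → a < x →
          BelowBoth y z (a ∷ x ∷ λ₁ ++ λ₂ ++ μ) →
          MatchesPi π a (λ₁ ++ λ₂) z μ →
          RForm π (a ∷ x ∷ λ₁ ++ y ∷ λ₂ ++ z ∷ μ)
  -- a x λ₂ z μ with x = y (λ₁ empty)
  a-xy  : ∀ {a x z λ₂ μ} → a < x →
          BelowBoth x z (a ∷ λ₂ ++ μ) →
          MatchesPi π a λ₂ z μ →
          RForm π (a ∷ x ∷ λ₂ ++ z ∷ μ)
  -- x a λ₁ y λ₂ z μ with x ≠ y
  x-a-y : ∀ {a x y z λ₁ λ₂ μ} → a < x →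
          BelowBoth y z (x ∷ a ∷ λ₁ ++ λ₂ ++ μ) →
          MatchesPi π a (λ₁ ++ λ₂) z μ →
          RForm π (x ∷ a ∷ λ₁ ++ y ∷ λ₂ ++ z ∷ μ)
  -- x a λ₂ z μ with x = y (λ₁ empty)
  xy-a  : ∀ {a x z λ₂ μ} → a < x →
          BelowBoth x z (a ∷ λ₂ ++ μ) →
          MatchesPi π a λ₂ z μ →
          RForm π (x ∷ a ∷ λ₂ ++ z ∷ μ)

InR : List ℕ → List ℕ → Set
InR π τ = IsPerm τ × ∃ λ ρ → Unique ρ × RForm π ρ × τ ≅ ρ

-- B is one left-to-right pass of bubble sort: the pass carries the largest term
-- seen so far, emits it when a larger term comes along, and emits every other
-- term in place.  Take an occurrence  a x λ₁ y λ₂ z μ  (or  x a …) of the R(π)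
-- pattern in σ.  Since  a λ z μ ≅ π  and π has only two left-to-right maxima,
-- every term of λ lies below a.  When the pass leaves the block holding a and x
-- it carries something ≥ x > a, so a has been emitted, and the terms of λ, being
-- smaller, are emitted in order after it.  At z's position it emits the smaller
-- n of z and the carried term (by now ≥ y); n exceeds a, λ and μ, and μ then
-- follows in order.  Hence B(σ) contains a λ n μ, which is order
-- isomorphic to a λ z μ and so to π.

module Submission where

open import Defs
open import Data.Bool using (true; false; if_then_else_)
open import Data.Empty using (⊥-elim)
open import Data.List using (List; []; _∷_; _++_; [_]; length; map)
open import Data.List.Properties using (++-assoc; map-++; length-++; ∷-injective)
open import Data.List.Membership.Propositional using (_∈_)
open import Data.List.Membership.Propositional.Properties using (∈-map⁺; ∈-map⁻; ∈-++⁺ʳ)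
open import Data.List.Relation.Unary.All as All using (All; []; _∷_)
import Data.List.Relation.Unary.All.Properties as All
open import Data.List.Relation.Unary.Any using (here; there)
open import Data.List.Relation.Unary.AllPairs as AllPairs using (AllPairs; []; _∷_)
open import Data.List.Relation.Unary.Unique.Propositional using (Unique)
open import Data.List.Relation.Binary.Pointwise as Pointwise using (Pointwise; []; _∷_)
open import Data.List.Relation.Binary.Sublist.Propositional
  using (_⊆_; []; _∷_; _∷ʳ_; ⊆-refl; ⊆-trans; ⊆-reflexive; lookup; from∈)
open import Data.List.Relation.Binary.Sublist.Propositional.Properties
  using (All-resp-⊆; map⁺; ++⁺; ++⁺ˡ; ++⁺ʳ; ∷ˡ⁻)
open import Data.Maybe using (Maybe; just; nothing)
open import Data.Nat using (ℕ; zero; suc; _<_; _≤_; _<ᵇ_; _⊓_; z≤n; s≤s; s≤s⁻¹; z<s)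
open import Data.Nat.Properties
  using (≤-refl; ≤-trans; <-trans; <-≤-trans; <⇒≤; <-asym; <-irrefl; <⇒≱; ≮⇒≥; ≤∧≢⇒<; m<m+n;
         suc-injective; <ᵇ-reflects-<; ⊓-glb; ⊓-monoˡ-≤; m⊓n≤m; m⊓n≤n)
open import Data.Product using (∃; ∃₂; _×_; _,_; proj₁; proj₂; swap)
open import Function.Base using (_∘_)
open import Function.Bundles using (_⇔_; mk⇔; Equivalence)
open import Function.Construct.Identity using (⇔-id)
open import Function.Construct.Composition using (_⇔-∘_)
open import Relation.Binary.PropositionalEquality
  using (_≡_; _≢_; refl; sym; trans; cong; cong₂; subst; subst₂)
open import Relation.Nullary using (¬_)
open import Relation.Nullary.Reflects using (ofʸ; ofⁿ)

AllPairs-resp-⊆ : ∀ {A : Set} {R : A → A → Set} {xs ys} → xs ⊆ ys → AllPairs R ys → AllPairs R xs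
AllPairs-resp-⊆ []         []         = []
AllPairs-resp-⊆ (_ ∷ʳ xs⊆) (_ ∷ R*)   = AllPairs-resp-⊆ xs⊆ R*
AllPairs-resp-⊆ (refl ∷ xs⊆) (Rx ∷ R*) = All-resp-⊆ xs⊆ Rx ∷ AllPairs-resp-⊆ xs⊆ R*

⊆-++⁻ : ∀ {A : Set} (us : List A) {vs σ} → us ++ vs ⊆ σ →
        ∃₂ λ σ₁ σ₂ → σ ≡ σ₁ ++ σ₂ × us ⊆ σ₁ × vs ⊆ σ₂
⊆-++⁻ []       vs⊆ = [] , _ , refl , [] , vs⊆
⊆-++⁻ (u ∷ us) (y ∷ʳ p) with ⊆-++⁻ (u ∷ us) p
... | σ₁ , σ₂ , refl , us⊆ , vs⊆ = y ∷ σ₁ , σ₂ , refl , y ∷ʳ us⊆ , vs⊆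
⊆-++⁻ (u ∷ us) (refl ∷ p) with ⊆-++⁻ us p
... | σ₁ , σ₂ , refl , us⊆ , vs⊆ = u ∷ σ₁ , σ₂ , refl , refl ∷ us⊆ , vs⊆

⊆-map⁻ : ∀ {A B : Set} (f : A → B) {us} xs → us ⊆ map f xs → ∃ λ ws → ws ⊆ xs × map f ws ≡ us
⊆-map⁻ f []       []         = [] , [] , refl
⊆-map⁻ f (x ∷ xs) (_ ∷ʳ p)   with ⊆-map⁻ f xs p
... | ws , ws⊆ , refl = ws , x ∷ʳ ws⊆ , refl
⊆-map⁻ f (x ∷ xs) (refl ∷ p) with ⊆-map⁻ f xs p
... | ws , ws⊆ , refl = x ∷ ws , refl ∷ ws⊆ , refl

map≡++ : ∀ {A B : Set} (f : A → B) xs {us vs} → map f xs ≡ us ++ vs →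
         ∃₂ λ ys zs → xs ≡ ys ++ zs × map f ys ≡ us × map f zs ≡ vs
map≡++ f xs       {[]}     eq = [] , xs , refl , refl , eq
map≡++ f []       {_ ∷ _}  ()
map≡++ f (x ∷ xs) {_ ∷ us} eq with ∷-injective eq
... | refl , eq′ with map≡++ f xs {us} eq′
...   | ys , zs , refl , refl , refl = x ∷ ys , zs , refl , refl , refl

-- B as a bubble-sort pass

bubble : ℕ → List ℕ → List ℕ
bubble c []       = []
bubble c (x ∷ xs) = if c <ᵇ x then c ∷ bubble x xs else x ∷ bubble c xs

carry : ℕ → List ℕ → ℕ
carry c []       = c
carry c (x ∷ xs) = if c <ᵇ x then carry x xs else carry c xs

bubblePass : List ℕ → List ℕ
bubblePass []       = []
bubblePass (x ∷ xs) = bubble x xs ++ [ carry x xs ]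

bubble-++ : ∀ c xs ys → bubble c (xs ++ ys) ≡ bubble c xs ++ bubble (carry c xs) ys
bubble-++ c []       ys = refl
bubble-++ c (x ∷ xs) ys with c <ᵇ x
... | true  = cong (c ∷_) (bubble-++ x xs ys)
... | false = cong (x ∷_) (bubble-++ c xs ys)

carry-++ : ∀ c xs ys → carry c (xs ++ ys) ≡ carry (carry c xs) ys
carry-++ c []       ys = refl
carry-++ c (x ∷ xs) ys with c <ᵇ x
... | true  = carry-++ x xs ys
... | false = carry-++ c xs ys

carry-upper : ∀ c xs → All (_≤ carry c xs) (c ∷ xs)
carry-upper c []       = ≤-refl ∷ []
carry-upper c (x ∷ xs) with c <ᵇ x | <ᵇ-reflects-< c x
... | true  | ofʸ c<x = <⇒≤ (<-≤-trans c<x (All.head x∷xs≤)) ∷ x∷xs≤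
  where x∷xs≤ = carry-upper x xs
... | false | ofⁿ c≮x = All.head c∷xs≤ ∷ ≤-trans (≮⇒≥ c≮x) (All.head c∷xs≤) ∷ All.tail c∷xs≤
  where c∷xs≤ = carry-upper c xs

bubble-dominated : ∀ {c r} → All (_≤ c) r → bubble c r ≡ r
bubble-dominated {c} {[]}    []          = refl
bubble-dominated {c} {x ∷ r} (x≤c ∷ r≤c) with c <ᵇ x | <ᵇ-reflects-< c x
... | true  | ofʸ c<x = ⊥-elim (<⇒≱ c<x x≤c)
... | false | _       = cong (x ∷_) (bubble-dominated r≤c)

carry-dominated : ∀ {c r} → All (_≤ c) r → carry c r ≡ c
carry-dominated {c} {[]}    []          = refl
carry-dominated {c} {x ∷ r} (x≤c ∷ r≤c) with c <ᵇ x | <ᵇ-reflects-< c x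
... | true  | ofʸ c<x = ⊥-elim (<⇒≱ c<x x≤c)
... | false | _       = carry-dominated r≤c

bubble-below-max : ∀ {c m} xs {r} → All (_< m) (c ∷ xs) → All (_≤ m) r →
                   bubble c (xs ++ m ∷ r) ≡ bubble c xs ++ carry c xs ∷ r
bubble-below-max {c} {m} [] (c<m ∷ []) r≤m with c <ᵇ m | <ᵇ-reflects-< c m
... | true  | _        = cong (c ∷_) (bubble-dominated r≤m)
... | false | ofⁿ c≮m = ⊥-elim (c≮m c<m)
bubble-below-max {c} (x ∷ xs) (c<m ∷ x<m ∷ xs<m) r≤m with c <ᵇ x
... | true  = cong (c ∷_) (bubble-below-max xs (x<m ∷ xs<m) r≤m)
... | false = cong (x ∷_) (bubble-below-max xs (c<m ∷ xs<m) r≤m)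

carry-below-max : ∀ {c m} xs {r} → All (_< m) (c ∷ xs) → All (_≤ m) r → carry c (xs ++ m ∷ r) ≡ m
carry-below-max {c} {m} [] (c<m ∷ []) r≤m with c <ᵇ m | <ᵇ-reflects-< c m
... | true  | _        = carry-dominated r≤m
... | false | ofⁿ c≮m = ⊥-elim (c≮m c<m)
carry-below-max {c} (x ∷ xs) (c<m ∷ x<m ∷ xs<m) r≤m with c <ᵇ x
... | true  = carry-below-max xs (x<m ∷ xs<m) r≤m
... | false = carry-below-max xs (c<m ∷ xs<m) r≤m

bubblePass-split : ∀ l {m r} → All (_< m) l → All (_≤ m) r →
                   bubblePass (l ++ m ∷ r) ≡ bubblePass l ++ r ++ [ m ]
bubblePass-split []      [] r≤m = cong₂ (λ xs c → xs ++ [ c ]) (bubble-dominated r≤m) (carry-dominated r≤m)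
bubblePass-split (h ∷ t) {m} {r} l<m r≤m
  rewrite bubble-below-max t l<m r≤m | carry-below-max t l<m r≤m =
  trans (++-assoc (bubble h t) (carry h t ∷ r) [ m ]) (sym (++-assoc (bubble h t) [ carry h t ] (r ++ [ m ])))

MaxSplit : List ℕ → Maybe Split → Set
MaxSplit σ nothing                 = σ ≡ []
MaxSplit σ (just (split l m r)) = σ ≡ l ++ m ∷ r × All (_< m) l × All (_≤ m) r

splitMax-correct : ∀ {σ} → Unique σ → MaxSplit σ (splitMax σ)
splitMax-correct {[]}         _ = refl
splitMax-correct {x ∷ []}     _ = refl , [] , []
splitMax-correct {x ∷ y ∷ ys} (x∉ ∷ u) with splitMax (y ∷ ys) | splitMax-correct u
... | just (split l m r) | eq , l<m , r≤m with m <ᵇ x | <ᵇ-reflects-< m x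
...   | true  | ofʸ m<x = refl , [] , subst (All (_≤ x)) (sym eq) (All.++⁺ (All.map (λ e<m → <⇒≤ (<-trans e<m m<x)) l<m)
                                        (<⇒≤ m<x ∷ All.map (λ e≤m → ≤-trans e≤m (<⇒≤ m<x)) r≤m))
...   | false | ofⁿ m≮x = cong (x ∷_) eq , ≤∧≢⇒< (≮⇒≥ m≮x) x≢m ∷ l<m , r≤m
  where x≢m = All.head (All.++⁻ʳ l (subst (All (x ≢_)) eq x∉))

Bfuel≡bubblePass : ∀ {k σ} → length σ ≤ k → Unique σ → Bfuel k σ ≡ bubblePass σ
Bfuel≡bubblePass {zero}  {[]} _ _ = refl
Bfuel≡bubblePass {suc k} {σ} |σ|≤ uσ with splitMax σ | splitMax-correct uσ
... | nothing            | refl = refl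
... | just (split l m r) | refl , l<m , r≤m =
  trans (cong (_++ r ++ [ m ]) (Bfuel≡bubblePass |l|≤k (AllPairs-resp-⊆ (++⁺ʳ (m ∷ r) ⊆-refl) uσ)))
        (sym (bubblePass-split l l<m r≤m))
  where
  |l|≤k : length l ≤ k
  |l|≤k = s≤s⁻¹ (<-≤-trans (subst (length l <_) (sym (length-++ l)) (m<m+n (length l) z<s)) |σ|≤)

B≡bubblePass : ∀ {σ} → Unique σ → B σ ≡ bubblePass σ
B≡bubblePass = Bfuel≡bubblePass ≤-refl

⊆-bubble-below : ∀ {c w ys} → w ⊆ ys → All (_< c) w → w ⊆ bubble c ys
⊆-bubble-below []               [] = []
⊆-bubble-below {c} (y ∷ʳ w⊆) w<c with c <ᵇ y | <ᵇ-reflects-< c y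
... | true  | ofʸ c<y = c ∷ʳ ⊆-bubble-below w⊆ (All.map (λ e<c → <-trans e<c c<y) w<c)
... | false | _       = y ∷ʳ ⊆-bubble-below w⊆ w<c
⊆-bubble-below {c} {e ∷ _} (refl ∷ w⊆) (e<c ∷ w<c) with c <ᵇ e | <ᵇ-reflects-< c e
... | true  | ofʸ c<e = ⊥-elim (<-asym e<c c<e)
... | false | _       = refl ∷ ⊆-bubble-below w⊆ w<c

∈-bubble : ∀ {e c} ys → e ∈ c ∷ ys → e < carry c ys → e ∈ bubble c ys
∈-bubble         []       (here refl) e<e = ⊥-elim (<-irrefl refl e<e)
∈-bubble {c = c} (y ∷ ys) e∈ e< with c <ᵇ y | e∈
... | true  | here refl        = here refl
... | true  | there e∈y∷ys     = there (∈-bubble ys e∈y∷ys e<)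
... | false | here refl        = there (∈-bubble ys (here refl) e<)
... | false | there (here refl) = here refl
... | false | there (there e∈ys) = there (∈-bubble ys (there e∈ys) e<)

∷⊆-bubble : ∀ {c z μ ys} → z ∷ μ ⊆ ys → All (λ e → e < c × e < z) μ →
            ∃ λ n → c ⊓ z ≤ n × n ∷ μ ⊆ bubble c ys
∷⊆-bubble {c} (y ∷ʳ p) μ< with c <ᵇ y | <ᵇ-reflects-< c y
... | true  | ofʸ c<y = let n , y⊓z≤n , n∷μ⊆ = ∷⊆-bubble p (All.map (λ (e<c , e<z) → <-trans e<c c<y , e<z) μ<)
                       in n , ≤-trans (⊓-monoˡ-≤ _ (<⇒≤ c<y)) y⊓z≤n , c ∷ʳ n∷μ⊆
... | false | _       = let n , c⊓z≤n , n∷μ⊆ = ∷⊆-bubble p μ< in n , c⊓z≤n , y ∷ʳ n∷μ⊆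
∷⊆-bubble {c} {z} (refl ∷ p) μ< with c <ᵇ z | <ᵇ-reflects-< c z
... | true  | _ = c , m⊓n≤m c z , refl ∷ ⊆-bubble-below p (All.map proj₂ μ<)
... | false | _ = z , m⊓n≤n c z , refl ∷ ⊆-bubble-below p (All.map proj₁ μ<)

bubblePass-pattern : ∀ {h t σ₂ σ₃ a x y z lam μ} →
  a ∈ h ∷ t → x ∈ h ∷ t → lam ⊆ σ₂ → y ∈ h ∷ t ++ σ₂ → z ∷ μ ⊆ σ₃ →
  a < x → All (_< a) lam → All (λ e → e < y × e < z) μ →
  ∃ λ n → y ⊓ z ≤ n × a ∷ lam ++ n ∷ μ ⊆ bubblePass (h ∷ t ++ σ₂ ++ σ₃)
bubblePass-pattern {h} {t} {σ₂} {σ₃} {a} {x} {y} {z} {lam} {μ} a∈ x∈ lam⊆ y∈ z∷μ⊆ a<x lam<a μ< =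
  let n , c₂⊓z≤n , n∷μ⊆ = ∷⊆-bubble z∷μ⊆ (All.map (λ (e<y , e<z) → <-≤-trans e<y y≤c₂ , e<z) μ<)
  in n , ≤-trans (⊓-monoˡ-≤ z y≤c₂) c₂⊓z≤n ,
     subst (λ bs → a ∷ lam ++ n ∷ μ ⊆ bs ++ [ carry h (t ++ σ₂ ++ σ₃) ]) (sym blocks)
           (++⁺ʳ _ (++⁺ (from∈ (∈-bubble t a∈ a<c₁))
                        (++⁺ (⊆-bubble-below lam⊆ (All.map (λ e<a → <-trans e<a a<c₁) lam<a)) n∷μ⊆)))
  where
  c₁ = carry h t
  c₂ = carry c₁ σ₂
  a<c₁ : a < c₁
  a<c₁ = <-≤-trans a<x (All.lookup (carry-upper h t) x∈)
  y≤c₂ : y ≤ c₂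
  y≤c₂ = subst (y ≤_) (carry-++ h t σ₂) (All.lookup (carry-upper h (t ++ σ₂)) y∈)
  blocks : bubble h (t ++ σ₂ ++ σ₃) ≡ bubble h t ++ bubble c₁ σ₂ ++ bubble c₂ σ₃
  blocks = trans (bubble-++ h t (σ₂ ++ σ₃)) (cong (bubble h t ++_) (bubble-++ c₁ σ₂ σ₃))

SameOrder : ℕ × ℕ → ℕ × ℕ → Set
SameOrder p q = ((proj₁ p < proj₁ q) ⇔ (proj₂ p < proj₂ q)) × ((proj₁ q < proj₁ p) ⇔ (proj₂ q < proj₂ p))

≅⇒pairs : ∀ {xs ys} → xs ≅ ys → ∃ λ ps → map proj₁ ps ≡ xs × map proj₂ ps ≡ ys × AllPairs SameOrder ps
≅⇒pairs []                             = [] , refl , refl , []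
≅⇒pairs {x ∷ _} {y ∷ _} (x∼ ∷ xs≅ys) with ≅⇒pairs xs≅ys
... | ps , refl , refl , ps-ordered = (x , y) ∷ ps , refl , refl , pointwise⇒All ps x∼ ∷ ps-ordered
  where
  pointwise⇒All : ∀ {p} ps → Pointwise (λ x′ y′ → SameOrder p (x′ , y′)) (map proj₁ ps) (map proj₂ ps) →
                  All (SameOrder p) ps
  pointwise⇒All []       []         = []
  pointwise⇒All (_ ∷ ps) (p∼ ∷ ps∼) = p∼ ∷ pointwise⇒All ps ps∼

pairs⇒≅ : ∀ {ps} → AllPairs SameOrder ps → map proj₁ ps ≅ map proj₂ ps
pairs⇒≅ []                  = []
pairs⇒≅ (p∼ps ∷ ps-ordered) = All⇒pointwise p∼ps ∷ pairs⇒≅ ps-ordered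
  where
  All⇒pointwise : ∀ {p ps} → All (SameOrder p) ps →
                  Pointwise (λ x′ y′ → SameOrder p (x′ , y′)) (map proj₁ ps) (map proj₂ ps)
  All⇒pointwise []         = []
  All⇒pointwise (p∼ ∷ ps∼) = p∼ ∷ All⇒pointwise ps∼

<-pull : ∀ {ps p q} → AllPairs SameOrder ps → p ∈ ps → q ∈ ps → proj₂ p < proj₂ q → proj₁ p < proj₁ q
<-pull (_ ∷ _)          (here refl) (here refl) p<p = ⊥-elim (<-irrefl refl p<p)
<-pull (p∼ps ∷ _)       (here refl) (there q∈)  p<q = Equivalence.from (proj₁ (All.lookup p∼ps q∈)) p<q
<-pull (q∼ps ∷ _)       (there p∈)  (here refl) p<q = Equivalence.from (proj₂ (All.lookup q∼ps p∈)) p<q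
<-pull (_ ∷ ps-ordered) (there p∈)  (there q∈)  p<q = <-pull ps-ordered p∈ q∈ p<q

below-pull : ∀ {ps qs y z} → AllPairs SameOrder ps → qs ⊆ ps → y ∈ ps → z ∈ ps →
             BelowBoth (proj₂ y) (proj₂ z) (map proj₂ qs) → BelowBoth (proj₁ y) (proj₁ z) (map proj₁ qs)
below-pull ordered qs⊆ y∈ z∈ below = All.map⁺ (All.tabulate λ q∈ →
  let (q<y , q<z) = All.lookup (All.map⁻ below) q∈
  in <-pull ordered (lookup qs⊆ q∈) y∈ q<y , <-pull ordered (lookup qs⊆ q∈) z∈ q<z)

≅-refl : ∀ {xs} → xs ≅ xs
≅-refl {[]}     = []
≅-refl {x ∷ xs} = Pointwise.refl (⇔-id _ , ⇔-id _) ∷ ≅-refl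

≅-trans : ∀ {xs ys zs} → xs ≅ ys → ys ≅ zs → xs ≅ zs
≅-trans []             []             = []
≅-trans (x∼ ∷ xs≅ys) (y∼ ∷ ys≅zs) =
  Pointwise.transitive (λ (f , g) (f′ , g′) → f′ ⇔-∘ f , g′ ⇔-∘ g) x∼ y∼ ∷ ≅-trans xs≅ys ys≅zs

below-both⇒SameOrder : ∀ {e n z} → e < n × e < z → SameOrder (e , e) (n , z)
below-both⇒SameOrder (e<n , e<z) =
  mk⇔ (λ _ → e<z) (λ _ → e<n) , mk⇔ (λ n<e → ⊥-elim (<-asym n<e e<n)) (λ z<e → ⊥-elim (<-asym z<e e<z))

≅-replace-max : ∀ u {n z v} → All (λ e → e < n × e < z) (u ++ v) → u ++ n ∷ v ≅ u ++ z ∷ v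
≅-replace-max []      below = diagonal (All.map (swap ∘ below-both⇒SameOrder) below) ∷ ≅-refl
  where
  diagonal : ∀ {R : ℕ → ℕ → Set} {v} → All (λ e → R e e) v → Pointwise R v v
  diagonal []       = []
  diagonal (r ∷ rs) = r ∷ diagonal rs
≅-replace-max (w ∷ u) (w-below ∷ below) =
  Pointwise.++⁺ (Pointwise.refl (⇔-id _ , ⇔-id _)) (below-both⇒SameOrder w-below ∷ Pointwise.refl (⇔-id _ , ⇔-id _))
  ∷ ≅-replace-max u below

ltrMaxGo-resp-≅ : ∀ {c d xs ys} → c ∷ xs ≅ d ∷ ys → length (ltrMaxGo (just c) xs) ≡ length (ltrMaxGo (just d) ys)
ltrMaxGo-resp-≅ (_ ∷ []) = refl
ltrMaxGo-resp-≅ {c} {d} {x ∷ xs} {y ∷ ys} (((c<x⇔d<y , _) ∷ c∼) ∷ x∷xs≅y∷ys@(_ ∷ xs≅ys))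
  with c <ᵇ x | <ᵇ-reflects-< c x | d <ᵇ y | <ᵇ-reflects-< d y
... | true  | _        | true  | _        = cong suc (ltrMaxGo-resp-≅ x∷xs≅y∷ys)
... | true  | ofʸ c<x  | false | ofⁿ d≮y = ⊥-elim (d≮y (Equivalence.to c<x⇔d<y c<x))
... | false | ofⁿ c≮x  | true  | ofʸ d<y = ⊥-elim (c≮x (Equivalence.from c<x⇔d<y d<y))
... | false | _        | false | _        = ltrMaxGo-resp-≅ (c∼ ∷ xs≅ys)

ltrMaxima-resp-≅ : ∀ {xs ys} → xs ≅ ys → length (ltrMaxima xs) ≡ length (ltrMaxima ys)
ltrMaxima-resp-≅ []             = refl
ltrMaxima-resp-≅ xs≅ys@(_ ∷ _) = cong suc (ltrMaxGo-resp-≅ xs≅ys)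

ltrMaxGo-nonempty : ∀ {m e xs} → m < e → e ∈ xs → 1 ≤ length (ltrMaxGo (just m) xs)
ltrMaxGo-nonempty {m} {xs = x ∷ xs} m<e e∈ with m <ᵇ x | <ᵇ-reflects-< m x | e∈
... | true  | _        | _          = s≤s z≤n
... | false | ofⁿ m≮x | here refl  = ⊥-elim (m≮x m<e)
... | false | _        | there e∈xs = ltrMaxGo-nonempty m<e e∈xs

ltrMaxGo-atLeastTwo : ∀ {m e n} α {β} → m < e → e ∈ α → All (_< n) α → 2 ≤ length (ltrMaxGo (just m) (α ++ n ∷ β))
ltrMaxGo-atLeastTwo {m} (x ∷ α) m<e e∈ (x<n ∷ α<n) with m <ᵇ x | <ᵇ-reflects-< m x | e∈
... | true  | _        | _         = s≤s (ltrMaxGo-nonempty x<n (∈-++⁺ʳ α (here refl)))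
... | false | ofⁿ m≮x | here refl = ⊥-elim (m≮x m<e)
... | false | _        | there e∈α = ltrMaxGo-atLeastTwo α m<e e∈α α<n

two-ltrMaxima⇒below-first : ∀ {a n} α {β} → length (ltrMaxima (a ∷ α ++ n ∷ β)) ≡ 2 →
                            All (_< n) α → All (a ≢_) α → All (_< a) α
two-ltrMaxima⇒below-first α two α<n a≢α = All.tabulate λ {e} e∈α →
  ≤∧≢⇒< (≮⇒≥ λ a<e → <-irrefl refl (subst (2 ≤_) (suc-injective two) (ltrMaxGo-atLeastTwo α a<e e∈α α<n)))
        (λ e≡a → All.lookup a≢α e∈α (sym e≡a))

-- What the argument needs from  a x λ₁ y λ₂ z μ : blocks σ₁ σ₂ σ₃ of σ holding
-- {a, x}, λ = λ₁λ₂ and z μ, with y before σ₃.  Unlike RForm, this is preserved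
-- under order isomorphism and under passing to a supersequence.
data Occurrence (π σ : List ℕ) : Set where
  occurrence : ∀ {a x y z lam μ} σ₁ σ₂ σ₃ → σ ≡ σ₁ ++ σ₂ ++ σ₃ →
               a ∈ σ₁ → x ∈ σ₁ → lam ⊆ σ₂ → y ∈ σ₁ ++ σ₂ → z ∷ μ ⊆ σ₃ →
               a < x → BelowBoth y z (a ∷ lam ++ μ) → a ∷ lam ++ z ∷ μ ≅ π →
               Occurrence π σ

MatchesPi⇒≅ : ∀ {π a lam z μ} → MatchesPi π a lam z μ → a ∷ lam ++ z ∷ μ ≅ π
MatchesPi⇒≅ (_ , _ , _ , _ , _ , _ , _ , ≅π) = ≅π

RForm⇒Occurrence : ∀ {π ρ} → RForm π ρ → Occurrence π ρ
RForm⇒Occurrence (a-x-y {a} {x} {y} {z} {λ₁} {λ₂} {μ} _ a<x below matches) =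
  occurrence (a ∷ x ∷ []) (λ₁ ++ y ∷ λ₂) (z ∷ μ) (cong (λ l → a ∷ x ∷ l) (sym (++-assoc λ₁ (y ∷ λ₂) (z ∷ μ))))
    (here refl) (there (here refl)) (++⁺ ⊆-refl (y ∷ʳ ⊆-refl)) (there (there (∈-++⁺ʳ λ₁ (here refl)))) ⊆-refl
    a<x (All-resp-⊆ (refl ∷ x ∷ʳ ⊆-reflexive (++-assoc λ₁ λ₂ μ)) below) (MatchesPi⇒≅ matches)
RForm⇒Occurrence (x-a-y {a} {x} {y} {z} {λ₁} {λ₂} {μ} a<x below matches) =
  occurrence (x ∷ a ∷ []) (λ₁ ++ y ∷ λ₂) (z ∷ μ) (cong (λ l → x ∷ a ∷ l) (sym (++-assoc λ₁ (y ∷ λ₂) (z ∷ μ))))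
    (there (here refl)) (here refl) (++⁺ ⊆-refl (y ∷ʳ ⊆-refl)) (there (there (∈-++⁺ʳ λ₁ (here refl)))) ⊆-refl
    a<x (All-resp-⊆ (x ∷ʳ refl ∷ ⊆-reflexive (++-assoc λ₁ λ₂ μ)) below) (MatchesPi⇒≅ matches)
RForm⇒Occurrence (a-xy {a} {x} {z} {λ₂} {μ} a<x below matches) =
  occurrence (a ∷ x ∷ []) λ₂ (z ∷ μ) refl (here refl) (there (here refl)) ⊆-refl (there (here refl)) ⊆-refl
    a<x below (MatchesPi⇒≅ matches)
RForm⇒Occurrence (xy-a {a} {x} {z} {λ₂} {μ} a<x below matches) =
  occurrence (x ∷ a ∷ []) λ₂ (z ∷ μ) refl (there (here refl)) (here refl) ⊆-refl (here refl) ⊆-refl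
    a<x below (MatchesPi⇒≅ matches)

Occurrence-⊆ : ∀ {π s σ} → s ⊆ σ → Occurrence π s → Occurrence π σ
Occurrence-⊆ s⊆σ (occurrence σ₁ σ₂ σ₃ refl a∈ x∈ lam⊆ y∈ z∷μ⊆ a<x below ≅π) with ⊆-++⁻ σ₁ s⊆σ
... | τ₁ , τ₂₃ , refl , σ₁⊆ , σ₂₃⊆ with ⊆-++⁻ σ₂ σ₂₃⊆
...   | τ₂ , τ₃ , refl , σ₂⊆ , σ₃⊆ =
  occurrence τ₁ τ₂ τ₃ refl (lookup σ₁⊆ a∈) (lookup σ₁⊆ x∈) (⊆-trans lam⊆ σ₂⊆) (lookup (++⁺ σ₁⊆ σ₂⊆) y∈)
    (⊆-trans z∷μ⊆ σ₃⊆) a<x below ≅π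

Occurrence-pull : ∀ {π ps} → AllPairs SameOrder ps → Occurrence π (map proj₂ ps) → Occurrence π (map proj₁ ps)
Occurrence-pull {ps = ps} ordered (occurrence σ₁ σ₂ σ₃ blocks a∈ x∈ lam⊆ y∈ z∷μ⊆ a<x below ≅π)
  with map≡++ proj₂ ps {σ₁} blocks
... | ps₁ , ps₂₃ , refl , refl , blocks₂₃ with map≡++ proj₂ ps₂₃ {σ₂} blocks₂₃
... | ps₂ , ps₃ , refl , refl , refl
  with ∈-map⁻ proj₂ a∈ | ∈-map⁻ proj₂ x∈ | ⊆-map⁻ proj₂ ps₂ lam⊆
     | ∈-map⁻ proj₂ (subst (_ ∈_) (sym (map-++ proj₂ ps₁ ps₂)) y∈) | ⊆-map⁻ proj₂ ps₃ z∷μ⊆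
... | _ | _ | _ | _ | [] , _ , ()
... | A , A∈ , refl | X , X∈ , refl | L , L⊆ , refl | Y , Y∈ , refl | Z ∷ M , Z∷M⊆ , refl =
  occurrence (map proj₁ ps₁) (map proj₁ ps₂) (map proj₁ ps₃)
    (trans (map-++ proj₁ ps₁ _) (cong (map proj₁ ps₁ ++_) (map-++ proj₁ ps₂ ps₃)))
    (∈-map⁺ proj₁ A∈) (∈-map⁺ proj₁ X∈) (map⁺ proj₁ L⊆) (subst (_ ∈_) (map-++ proj₁ ps₁ ps₂) (∈-map⁺ proj₁ Y∈))
    (map⁺ proj₁ Z∷M⊆)
    (<-pull ordered (lookup ps₁⊆ A∈) (lookup ps₁⊆ X∈) a<x)
    (subst (BelowBoth (proj₁ Y) (proj₁ Z)) (map-∷++ proj₁ A L M)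
      (below-pull ordered A∷L++M⊆ (lookup ps₁₂⊆ Y∈) (lookup (++⁺ˡ ps₁ (++⁺ˡ ps₂ Z∷M⊆)) (here refl))
        (subst (BelowBoth (proj₂ Y) (proj₂ Z)) (sym (map-∷++ proj₂ A L M)) below)))
    (≅-trans (subst₂ _≅_ (map-∷++ proj₁ A L (Z ∷ M)) (map-∷++ proj₂ A L (Z ∷ M))
               (pairs⇒≅ (AllPairs-resp-⊆ (++⁺ (from∈ A∈) (++⁺ L⊆ Z∷M⊆)) ordered)))
             ≅π)
  where
  ps₁⊆ : ps₁ ⊆ ps₁ ++ ps₂ ++ ps₃
  ps₁⊆ = ++⁺ʳ _ ⊆-refl
  ps₁₂⊆ : ps₁ ++ ps₂ ⊆ ps₁ ++ ps₂ ++ ps₃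
  ps₁₂⊆ = ⊆-trans (++⁺ʳ ps₃ ⊆-refl) (⊆-reflexive (++-assoc ps₁ ps₂ ps₃))
  A∷L++M⊆ : A ∷ L ++ M ⊆ ps₁ ++ ps₂ ++ ps₃
  A∷L++M⊆ = ++⁺ (from∈ A∈) (++⁺ L⊆ (∷ˡ⁻ Z∷M⊆))
  map-∷++ : ∀ {A B : Set} (f : A → B) a xs ys → map f (a ∷ xs ++ ys) ≡ f a ∷ map f xs ++ map f ys
  map-∷++ f a xs ys = cong (f a ∷_) (map-++ f xs ys)

Occurrence-resp-≅ : ∀ {π s ρ} → s ≅ ρ → Occurrence π ρ → Occurrence π s
Occurrence-resp-≅ s≅ρ occ with ≅⇒pairs s≅ρ
... | ps , refl , refl , ordered = Occurrence-pull ordered occ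

Occurrence⇒B-contains : ∀ {π σ} → length (ltrMaxima π) ≡ 2 → Unique σ → Occurrence π σ → Contains (B σ) π
Occurrence⇒B-contains two uσ (occurrence [] _ _ _ () _ _ _ _ _ _ _)
Occurrence⇒B-contains two uσ (occurrence {a} {x} {y} {z} {lam} {μ} (h ∷ t) σ₂ σ₃ refl a∈ x∈ lam⊆ y∈ z∷μ⊆ a<x below ≅π) =
  let n , y⊓z≤n , pattern⊆ = bubblePass-pattern a∈ x∈ lam⊆ y∈ z∷μ⊆ a<x lam<a (All.++⁻ʳ lam (All.tail below))
      below-n = All.map (λ (e<y , e<z) → <-≤-trans (⊓-glb e<y e<z) y⊓z≤n , e<z) below
  in a ∷ lam ++ n ∷ μ , subst (a ∷ lam ++ n ∷ μ ⊆_) (sym (B≡bubblePass uσ)) pattern⊆ , ≅-trans (≅-replace-max (a ∷ lam) below-n) ≅π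
  where
  lam<a : All (_< a) lam
  lam<a = two-ltrMaxima⇒below-first lam (trans (ltrMaxima-resp-≅ ≅π) two)
            (All.map proj₂ (All.++⁻ˡ lam (All.tail below)))
            (AllPairs.head (AllPairs-resp-⊆ (++⁺ (from∈ a∈) (++⁺ʳ σ₃ lam⊆)) uσ))

-- Only the two left-to-right maxima of π are used.
lemma2p9 : (π : List ℕ) → IsPerm π → length (ltrMaxima π) ≡ 2 → ¬ EndsWithMax π →
           (σ : List ℕ) → Unique σ →
           (τ : List ℕ) → InR π τ → Contains σ τ →
           Contains (B σ) π
lemma2p9 π _ two _ σ uσ τ (_ , ρ , _ , ρ-form , τ≅ρ) (s , s⊆σ , s≅τ) =
  Occurrence⇒B-contains two uσ (Occurrence-⊆ s⊆σ (Occurrence-resp-≅ (≅-trans s≅τ τ≅ρ) (RForm⇒Occurrence ρ-form)))
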